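{- Let $p$ be an $\mathrm{evenlevel}(v)$ path or an $\mathrm{oddlevel}(v)$ path starting at an unmatched vertex $f$, and let $u$ be a vertex on $p$ with $\mathrm{t}(u)\ge \mathrm{t}(v)$. Then $u$ is BFS-honest with respect to $p$. Furthermore, if $\mathrm{t}(u)>\mathrm{t}(v)$ then $|p[f \text{ to } u]|=\mathrm{minlevel}(u)$.
   Context: $G=(V,E)$ is a finite undirected graph and $M$ a matching; edges in $M$ are matched, others unmatched; a vertex is unmatched if no matched edge is incident to it. An alternating path is a simple path whose edges alternate between matched and unmatched. $\mathrm{evenlevel}(v)$ ($\mathrm{oddlevel}(v)$) is the length of a minimum even (odd) length alternating path from some unmatched vertex to $v$ ($\infty$ if none); such a path is called an $\mathrm{evenlevel}(v)$ ($\mathrm{oddlevel}(v)$) path. $\mathrm{minlevel}(v)$ is the smaller of the two. Tenacity $\mathrm{t}(v)=\mathrm{evenlevel}(v)+\mathrm{oddlevel}(v)$. For $u$ on a path $p$ starting at $f$, $p[f\text{ to }u]$ is the subpath from $f$ to $u$ and $|\cdot|$ its length; $u$ is even (odd) w.r.t. $p$ if this length is even (odd), and $u$ is BFS-honest w.r.t. $p$ if $|p[f\text{ to }u]|=\mathrm{evenlevel}(u)$ when $u$ is even w.r.t. $p$, and $=\mathrm{oddlevel}(u)$ when $u$ is odd w.r.t. $p$. -}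

module Defs where

open import Data.Nat using (ℕ; zero; suc; _+_; _≤_; _<_; _%_; _⊓_)
open import Data.Fin using (Fin)
open import Data.List using (List; []; _∷_; length)
open import Data.List.Relation.Unary.Unique.Propositional using (Unique)
open import Data.Product using (Σ; _×_)
open import Data.Empty using (⊥)
open import Data.Unit using (⊤)
open import Relation.Nullary using (¬_)
open import Relation.Binary.PropositionalEquality using (_≡_)

data ℕ∞ : Set where
  fin : ℕ → ℕ∞
  ∞   : ℕ∞

_+∞_ : ℕ∞ → ℕ∞ → ℕ∞
fin a +∞ fin b = fin (a + b)
fin _ +∞ ∞     = ∞
∞     +∞ _     = ∞

_≤∞_ : ℕ∞ → ℕ∞ → Set
fin a ≤∞ fin b = a ≤ b
fin _ ≤∞ ∞     = ⊤
∞     ≤∞ fin _ = ⊥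
∞     ≤∞ ∞     = ⊤

_<∞_ : ℕ∞ → ℕ∞ → Set
fin a <∞ fin b = a < b
fin _ <∞ ∞     = ⊤
∞     <∞ _     = ⊥

min∞ : ℕ∞ → ℕ∞ → ℕ∞
min∞ (fin a) (fin b) = fin (a ⊓ b)
min∞ (fin a) ∞       = fin a
min∞ ∞       b       = b

Even Odd : ℕ → Set
Even k = k % 2 ≡ 0
Odd  k = k % 2 ≡ 1

record Graph (n : ℕ) : Set₁ where
  field
    Adj     : Fin n → Fin n → Set
    sym     : ∀ {x y} → Adj x y → Adj y x
    irrefl  : ∀ {x} → ¬ Adj x x

record Matching {n : ℕ} (G : Graph n) : Set₁ where
  field
    Mt      : Fin n → Fin n → Set
    edge    : ∀ {x y} → Mt x y → Graph.Adj G x y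
    sym     : ∀ {x y} → Mt x y → Mt y x
    unique  : ∀ {x y z} → Mt x y → Mt x z → y ≡ z

module _ {n : ℕ} {G : Graph n} (M : Matching G) where
  open Graph G
  open Matching M

  Unmatched : Fin n → Set
  Unmatched x = ∀ y → ¬ Mt x y

  Alternating : List (Fin n) → Set
  Alternating []                = ⊤
  Alternating (x ∷ [])          = ⊤
  Alternating (x ∷ y ∷ [])      = Adj x y
  Alternating (x ∷ y ∷ z ∷ ps)  =
    Adj x y × ((Mt x y → ¬ Mt y z) × (¬ Mt x y → Mt y z)) × Alternating (y ∷ z ∷ ps)

  lastOf : Fin n → List (Fin n) → Fin n
  lastOf x []       = x
  lastOf x (y ∷ ps) = lastOf y ps

  record APath (v : Fin n) : Set where
    field
      start      : Fin n
      rest       : List (Fin n)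
      unmatched  : Unmatched start
      alt        : Alternating (start ∷ rest)
      simple     : Unique (start ∷ rest)
      ends       : lastOf start rest ≡ v

    verts : List (Fin n)
    verts = start ∷ rest

    len : ℕ
    len = length rest

  open APath public

  IsLevel : (ℕ → Set) → Fin n → ℕ∞ → Set
  IsLevel Par v (fin k) =
    Σ (APath v) (λ p → len p ≡ k × Par (len p))
    × (∀ (p : APath v) → Par (len p) → k ≤ len p)
  IsLevel Par v ∞ = ∀ (p : APath v) → ¬ Par (len p)

  IsEvenLevel IsOddLevel : Fin n → ℕ∞ → Set
  IsEvenLevel = IsLevel Even
  IsOddLevel  = IsLevel Odd

  IsEvenLevelPath IsOddLevelPath : ∀ {v} → APath v → ℕ∞ → Set
  IsEvenLevelPath p l = Even (len p) × fin (len p) ≡ l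
  IsOddLevelPath  p l = Odd  (len p) × fin (len p) ≡ l

-- a vertex at distance i from the start along p, with
-- evenlevel ev and oddlevel od, is BFS-honest
BFSHonest : ℕ → ℕ∞ → ℕ∞ → Set
BFSHonest i ev od = (Even i → fin i ≡ ev) × (Odd i → fin i ≡ od)

-- Let p be a shortest alternating path of its parity from f to v, and u the vertex at position i
-- on p.  Follow any alternating path s ending on p[u to v] until it first meets that segment, at
-- position a of s and position b ≥ i of p.  If a and b have the same parity, continuing along p
-- gives an alternating path to v of the parity of p, so minimality of p forces b ≤ a, hence
-- i ≤ |s|.  Otherwise walking back along p gives an alternating path to u of the parity opposite
-- to i, of length a + b − i ≤ |s| + |p| − i.  Applied to a path to u of the parity of i shorter
-- than i and to a path to v of the other parity, this contradicts t(v) ≤ t(u); applied to the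
-- latter alone, it shows that the other level of u is at least i when t(v) < t(u).

module Submission where

open import Defs
open import Data.Nat using (ℕ; zero; suc; _+_; _≤_; _<_; parity)
open import Data.Nat.Properties
  using (+-comm; +-assoc; +-suc; +-identityʳ; ⊓-comm; ≤-trans; +-cancelˡ-≤; +-monoˡ-≤;
         +-monoʳ-≤; +-monoˡ-<; +-monoʳ-<; +-mono-<; +-mono-≤; <-irrefl; m≤m+n; m≤n⇒m<n∨m≡n;
         m≤n⇒m⊓n≡m; ≰⇒>; <⇒≱; _≤?_; suc-injective; module ≤-Reasoning)
open import Data.Nat.Tactic.RingSolver using (solve-∀)
open import Data.Parity as ℙ using (Parity; 0ℙ; 1ℙ; _⁻¹)
import Data.Parity.Properties as ℙ
open import Data.Fin using (Fin; zero; suc; toℕ; _≟_)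
open import Data.List using (List; []; _∷_; _++_; _∷ʳ_; _ʳ++_; length; lookup; reverse)
open import Data.List.Properties
  using (++-assoc; length-++; length-reverse; reverse-++; unfold-reverse; ∷-injectiveˡ)
open import Data.List.Relation.Unary.All as All using (All; []; _∷_)
import Data.List.Relation.Unary.All.Properties as All
open import Data.List.Relation.Unary.Any as Any using (Any; here; there)
import Data.List.Relation.Unary.Any.Properties as Anyₚ
import Data.List.Relation.Unary.First as First
open import Data.List.Relation.Unary.First.Properties using (toView)
open import Data.List.Relation.Unary.Unique.Propositional using (Unique; []; _∷_)
import Data.List.Relation.Unary.Unique.Propositional.Properties as Unique
open import Data.List.Relation.Binary.Disjoint.Propositional using (Disjoint)
import Data.List.Relation.Binary.Permutation.Setoid as Perm
import Data.List.Relation.Binary.Permutation.Setoid.Properties as Perm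
open import Data.List.Membership.Propositional using (_∈_; _∉_)
open import Data.List.Membership.Propositional.Properties using (∈-++⁺ˡ; ∈-++⁺ʳ; ∈-∃++)
import Data.List.Membership.DecPropositional as DecMembership
open import Data.Product using (Σ-syntax; _×_; _,_; proj₂)
open import Data.Sum using (_⊎_; inj₁; inj₂)
open import Data.Empty using (⊥-elim)
open import Data.Unit using (⊤; tt)
open import Function using (_∘_)
open import Function.Bundles using (_⇔_; mk⇔; Equivalence)
open import Relation.Nullary using (¬_; Dec; yes; no; contradiction)
open import Relation.Nullary.Decidable using (toSum)
open import Relation.Unary using (Pred; Decidable; ∁)
open import Relation.Binary.PropositionalEquality
  using (_≡_; _≢_; refl; sym; trans; cong; subst; subst₂; setoid; module ≡-Reasoning)

+∞-comm : ∀ a b → a +∞ b ≡ b +∞ a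
+∞-comm (fin a) (fin b) = cong fin (+-comm a b)
+∞-comm (fin _) ∞       = refl
+∞-comm ∞       (fin _) = refl
+∞-comm ∞       ∞       = refl

min∞-comm : ∀ a b → min∞ a b ≡ min∞ b a
min∞-comm (fin a) (fin b) = cong fin (⊓-comm a b)
min∞-comm (fin _) ∞       = refl
min∞-comm ∞       (fin _) = refl
min∞-comm ∞       ∞       = refl

≤∞-fin : ∀ {l k} → l ≤∞ fin k → Σ[ m ∈ ℕ ] l ≡ fin m × m ≤ k
≤∞-fin {fin m} m≤k = m , refl , m≤k

+∞-≤∞-fin : ∀ a {l c} → (fin a +∞ l) ≤∞ fin c → Σ[ m ∈ ℕ ] l ≡ fin m × a + m ≤ c
+∞-≤∞-fin a {fin m} le = m , refl , le

+∞-<∞-fin : ∀ a {l c} → (fin a +∞ l) <∞ fin c → Σ[ m ∈ ℕ ] l ≡ fin m × a + m < c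
+∞-<∞-fin a {fin m} lt = m , refl , lt

HasParity : Parity → ℕ → Set
HasParity 0ℙ = Even
HasParity 1ℙ = Odd

HasParity-2+ : ∀ π k → HasParity π k → HasParity π (2 + k)
HasParity-2+ 0ℙ k h = h
HasParity-2+ 1ℙ k h = h

HasParity-parity : ∀ k → HasParity (parity k) k
HasParity-parity zero          = refl
HasParity-parity (suc zero)    = refl
HasParity-parity (suc (suc k)) = HasParity-2+ (parity k) k (HasParity-parity k)

HasParity-functional : ∀ {π κ} k → HasParity π k → HasParity κ k → π ≡ κ
HasParity-functional {0ℙ} {0ℙ} _ _ _ = refl
HasParity-functional {1ℙ} {1ℙ} _ _ _ = refl
HasParity-functional {0ℙ} {1ℙ} _ e o = contradiction (trans (sym e) o) λ ()
HasParity-functional {1ℙ} {0ℙ} _ o e = contradiction (trans (sym e) o) λ ()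

HasParity⇒parity : ∀ {π} k → HasParity π k → parity k ≡ π
HasParity⇒parity k = HasParity-functional k (HasParity-parity k)

parity⇒HasParity : ∀ {π} k → parity k ≡ π → HasParity π k
parity⇒HasParity k refl = HasParity-parity k

parity-suc : ∀ k → parity (suc k) ≡ parity k ⁻¹
parity-suc k = trans (sym (ℙ.⁻¹-involutive _)) (cong _⁻¹ (ℙ.suc-homo-⁻¹ k))

≢⇒≡⁻¹ : ∀ {p q : Parity} → p ≢ q → p ≡ q ⁻¹
≢⇒≡⁻¹ {0ℙ} {0ℙ} p≢q = contradiction refl p≢q
≢⇒≡⁻¹ {0ℙ} {1ℙ} _   = refl
≢⇒≡⁻¹ {1ℙ} {0ℙ} _   = refl
≢⇒≡⁻¹ {1ℙ} {1ℙ} p≢q = contradiction refl p≢q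

+≡1ℙ⇒≡⁻¹ : ∀ p q → p ℙ.+ q ≡ 1ℙ → p ≡ q ⁻¹
+≡1ℙ⇒≡⁻¹ 0ℙ 1ℙ _ = refl
+≡1ℙ⇒≡⁻¹ 1ℙ 0ℙ _ = refl

parity-cancel : ∀ m b a n → m + b ≡ a + n → parity a ≡ parity b → parity m ≡ parity n
parity-cancel m b a n eq pa≡pb = ℙ.+-cancelʳ-≡ (parity b) (parity m) (parity n) (begin
  parity m ℙ.+ parity b  ≡⟨ ℙ.+-homo-+ m b ⟨
  parity (m + b)         ≡⟨ cong parity eq ⟩
  parity (a + n)         ≡⟨ ℙ.+-homo-+ a n ⟩
  parity a ℙ.+ parity n  ≡⟨ ℙ.+-comm (parity a) (parity n) ⟩
  parity n ℙ.+ parity a  ≡⟨ cong (parity n ℙ.+_) pa≡pb ⟩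
  parity n ℙ.+ parity b  ∎)
  where open ≡-Reasoning

parity-opposite : ∀ m i a b → m + i ≡ a + b → parity a ≢ parity b → parity m ≡ parity i ⁻¹
parity-opposite m i a b eq pa≢pb = +≡1ℙ⇒≡⁻¹ (parity m) (parity i) (begin
  parity m ℙ.+ parity i      ≡⟨ ℙ.+-homo-+ m i ⟨
  parity (m + i)             ≡⟨ cong parity eq ⟩
  parity (a + b)             ≡⟨ ℙ.+-homo-+ a b ⟩
  parity a ℙ.+ parity b      ≡⟨ cong (ℙ._+ parity b) (≢⇒≡⁻¹ pa≢pb) ⟩
  parity b ⁻¹ ℙ.+ parity b   ≡⟨ ℙ.p⁻¹+p≡1ℙ (parity b) ⟩
  1ℙ                         ∎)
  where open ≡-Reasoning

byParity : Parity → ℕ∞ → ℕ∞ → ℕ∞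
byParity 0ℙ ev od = ev
byParity 1ℙ ev od = od

byParity-+∞ : ∀ π ev od → byParity π ev od +∞ byParity (π ⁻¹) ev od ≡ ev +∞ od
byParity-+∞ 0ℙ ev od = refl
byParity-+∞ 1ℙ ev od = +∞-comm od ev

byParity-min∞ : ∀ π ev od → min∞ (byParity π ev od) (byParity (π ⁻¹) ev od) ≡ min∞ ev od
byParity-min∞ 0ℙ ev od = refl
byParity-min∞ 1ℙ ev od = min∞-comm od ev

byParity-BFSHonest : ∀ k ev od → byParity (parity k) ev od ≡ fin k → BFSHonest k ev od
byParity-BFSHonest k ev od picked =
  (λ even → trans (sym picked) (cong (λ π → byParity π ev od) (HasParity⇒parity k even))) ,
  (λ odd  → trans (sym picked) (cong (λ π → byParity π ev od) (HasParity⇒parity k odd)))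

-- The kind of edge number k (from 0) of an alternating walk whose first edge has kind π.
alternate : ℕ → Parity → Parity
alternate zero    π = π
alternate (suc k) π = alternate k (π ⁻¹)

alternate-+ : ∀ k m π → alternate (k + m) π ≡ alternate m (alternate k π)
alternate-+ zero    m π = refl
alternate-+ (suc k) m π = alternate-+ k m (π ⁻¹)

alternate-parity : ∀ k π → alternate k π ≡ parity k ℙ.+ π
alternate-parity zero    π = refl
alternate-parity (suc k) π = begin
  alternate k (π ⁻¹)    ≡⟨ alternate-parity k (π ⁻¹) ⟩
  parity k ℙ.+ π ⁻¹     ≡⟨ swap (parity k) π ⟩
  parity k ⁻¹ ℙ.+ π     ≡⟨ cong (ℙ._+ π) (parity-suc k) ⟨
  parity (suc k) ℙ.+ π  ∎
  where
  open ≡-Reasoning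
  swap : ∀ p q → p ℙ.+ q ⁻¹ ≡ p ⁻¹ ℙ.+ q
  swap 0ℙ q = refl
  swap 1ℙ q = ℙ.⁻¹-involutive q

alternate-0ℙ : ∀ k → alternate k 0ℙ ≡ parity k
alternate-0ℙ k = trans (alternate-parity k 0ℙ) (ℙ.+-identityʳ (parity k))

module _ {A : Set} where

  Unique-++⁻ˡ : ∀ xs {ys : List A} → Unique (xs ++ ys) → Unique xs
  Unique-++⁻ˡ []       _          = []
  Unique-++⁻ˡ (x ∷ xs) (x∉ ∷ uniq) = All.++⁻ˡ xs x∉ ∷ Unique-++⁻ˡ xs uniq

  Unique-++⁻ʳ : ∀ xs {ys : List A} → Unique (xs ++ ys) → Unique ys
  Unique-++⁻ʳ []       uniq       = uniq
  Unique-++⁻ʳ (x ∷ xs) (_ ∷ uniq) = Unique-++⁻ʳ xs uniq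

  Unique-++-∷⇒∉ : ∀ xs {y : A} {ys} → Unique (xs ++ y ∷ ys) → y ∉ xs
  Unique-++-∷⇒∉ (x ∷ xs) (x∉ ∷ _)   (here y≡x) =
    All.lookup x∉ (∈-++⁺ʳ xs (here refl)) (sym y≡x)
  Unique-++-∷⇒∉ (x ∷ xs) (_ ∷ uniq) (there y∈) = Unique-++-∷⇒∉ xs uniq y∈

  Unique-reverse : ∀ (xs : List A) → Unique xs → Unique (reverse xs)
  Unique-reverse xs =
    Perm.Unique-resp-↭ (setoid A) (Perm.↭-sym (setoid A) (Perm.↭-reverse (setoid A) xs))

  lookup-split : ∀ (xs : List A) i →
    Σ[ ys ∈ List A ] Σ[ zs ∈ List A ] xs ≡ ys ++ lookup xs i ∷ zs × length ys ≡ toℕ i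
  lookup-split (x ∷ xs) zero = [] , xs , refl , refl
  lookup-split (x ∷ xs) (suc i) with ys , zs , eq , |ys| ← lookup-split xs i
    = x ∷ ys , zs , cong (x ∷_) eq , cong suc |ys|

  split-at-first : ∀ {ℓ} {P : Pred A ℓ} → Decidable P → ∀ zs → Any P zs →
    Σ[ pre ∈ List A ] Σ[ w ∈ A ] Σ[ post ∈ List A ]
      zs ≡ pre ++ w ∷ post × All (∁ P) pre × P w
  split-at-first P? zs hit with toView (First.refine (λ {z} _ → toSum (P? z)) (First.fromAny hit))
  ... | First._++_∷_ pre∉ w∈ post = _ , _ , post , refl , pre∉ , w∈

module _ {n : ℕ} {G : Graph n} (M : Matching G) where
  open Graph G using (Adj) renaming (sym to Adj-sym)
  open Matching M using (Mt) renaming (sym to Mt-sym)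
  open Equivalence
  open DecMembership (_≟_ {n}) using (_∈?_)

  V : Set
  V = Fin n

  Edge : Parity → V → V → Set
  Edge π x y = Adj x y × (Mt x y ⇔ π ≡ 1ℙ)

  Edge-sym : ∀ {π x y} → Edge π x y → Edge π y x
  Edge-sym (xy , kind) = Adj-sym xy , mk⇔ (to kind ∘ Mt-sym) (Mt-sym ∘ from kind)

  AltWalk : Parity → List V → Set
  AltWalk π (x ∷ y ∷ ys) = Edge π x y × AltWalk (π ⁻¹) (y ∷ ys)
  AltWalk _ _            = ⊤

  Alternating⇒AltWalk : ∀ {π} x y ys → (Mt x y ⇔ π ≡ 1ℙ) → Alternating M (x ∷ y ∷ ys) →
    AltWalk π (x ∷ y ∷ ys)
  Alternating⇒AltWalk x y []       kind xy = (xy , kind) , tt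
  Alternating⇒AltWalk {π} x y (z ∷ zs) kind (xy , (m⇒¬m , ¬m⇒m) , alt) =
    (xy , kind) , Alternating⇒AltWalk y z zs (next π kind) alt
    where
    next : ∀ π → (Mt x y ⇔ π ≡ 1ℙ) → (Mt y z ⇔ π ⁻¹ ≡ 1ℙ)
    next 0ℙ kind = mk⇔ (λ _ → refl) (λ _ → ¬m⇒m λ m → contradiction (to kind m) λ ())
    next 1ℙ kind = mk⇔ (λ m → ⊥-elim (m⇒¬m (from kind refl) m)) λ ()

  AltWalk⇒Alternating : ∀ {π} xs → AltWalk π xs → Alternating M xs
  AltWalk⇒Alternating []           _              = tt
  AltWalk⇒Alternating (_ ∷ [])     _              = tt
  AltWalk⇒Alternating (_ ∷ _ ∷ []) ((xy , _) , _) = xy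
  AltWalk⇒Alternating {π} (x ∷ y ∷ z ∷ zs) ((xy , kxy) , walk@((_ , kyz) , _)) =
    xy , alternates π kxy kyz , AltWalk⇒Alternating (y ∷ z ∷ zs) walk
    where
    alternates : ∀ π → (Mt x y ⇔ π ≡ 1ℙ) → (Mt y z ⇔ π ⁻¹ ≡ 1ℙ) →
      (Mt x y → ¬ Mt y z) × (¬ Mt x y → Mt y z)
    alternates 0ℙ kxy kyz = (λ m → contradiction (to kxy m) λ ()) , λ _ → from kyz refl
    alternates 1ℙ kxy kyz =
      (λ _ m → contradiction (to kyz m) λ ()) , λ ¬m → ⊥-elim (¬m (from kxy refl))

  APath-AltWalk : ∀ {v} (p : APath M v) → AltWalk 0ℙ (verts p)
  APath-AltWalk p = walk (start p) (rest p) (unmatched p) (alt p)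
    where
    walk : ∀ x ys → Unmatched M x → Alternating M (x ∷ ys) → AltWalk 0ℙ (x ∷ ys)
    walk x []       _    _   = tt
    walk x (y ∷ ys) free alt = Alternating⇒AltWalk x y ys (mk⇔ (λ m → ⊥-elim (free y m)) λ ()) alt

  AltWalk-++⁻ˡ : ∀ {π} xs {ys} → AltWalk π (xs ++ ys) → AltWalk π xs
  AltWalk-++⁻ˡ []           _          = tt
  AltWalk-++⁻ˡ (x ∷ [])     _          = tt
  AltWalk-++⁻ˡ (x ∷ y ∷ xs) (e , walk) = e , AltWalk-++⁻ˡ (y ∷ xs) walk

  AltWalk-++⁻ʳ : ∀ {π} xs {ys} → AltWalk π (xs ++ ys) → AltWalk (alternate (length xs) π) ys
  AltWalk-++⁻ʳ []                    walk       = walk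
  AltWalk-++⁻ʳ (x ∷ [])     {[]}     _          = tt
  AltWalk-++⁻ʳ (x ∷ [])     {y ∷ ys} (_ , walk) = walk
  AltWalk-++⁻ʳ (x ∷ y ∷ xs)          (_ , walk) = AltWalk-++⁻ʳ (y ∷ xs) walk

  AltWalk-++⁺ : ∀ {π} xs {w ys} → AltWalk π (xs ∷ʳ w) →
    AltWalk (alternate (length xs) π) (w ∷ ys) → AltWalk π (xs ++ w ∷ ys)
  AltWalk-++⁺ []           _          walk = walk
  AltWalk-++⁺ (x ∷ [])     (e , _)    walk = e , walk
  AltWalk-++⁺ (x ∷ y ∷ xs) (e , init) walk = e , AltWalk-++⁺ (y ∷ xs) init walk

  AltWalk-ʳ++ : ∀ {π} x xs ys → AltWalk π (x ∷ xs) → AltWalk (π ⁻¹) (x ∷ ys) →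
    AltWalk (alternate (length xs) (π ⁻¹)) (xs ʳ++ x ∷ ys)
  AltWalk-ʳ++     x []       ys _          back = back
  AltWalk-ʳ++ {π} x (y ∷ xs) ys (e , walk) back =
    AltWalk-ʳ++ y xs (x ∷ ys) walk
      (subst (λ κ → AltWalk κ (y ∷ x ∷ ys)) (sym (ℙ.⁻¹-involutive π)) (Edge-sym e , back))

  AltWalk-reverse : ∀ {π} xs → AltWalk π xs → AltWalk (alternate (length xs) π) (reverse xs)
  AltWalk-reverse []       _    = tt
  AltWalk-reverse (x ∷ xs) walk = AltWalk-ʳ++ x xs [] walk tt

  lastOf-++ : ∀ x xs {w ys} → lastOf M x (xs ++ w ∷ ys) ≡ lastOf M w ys
  lastOf-++ x []       = refl
  lastOf-++ x (y ∷ xs) = lastOf-++ y xs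

  lastOf-∈ : ∀ x xs → lastOf M x xs ∈ x ∷ xs
  lastOf-∈ x []       = here refl
  lastOf-∈ x (y ∷ xs) = there (lastOf-∈ y xs)

  lastOf-reverse : ∀ w x xs → lastOf M w (reverse (x ∷ xs)) ≡ x
  lastOf-reverse w x xs = trans (cong (lastOf M w) (unfold-reverse x xs)) (lastOf-++ w (reverse xs))

  lastOf-split : ∀ {x xs u D} A → x ∷ xs ≡ A ++ u ∷ D → lastOf M x xs ≡ lastOf M u D
  lastOf-split []      refl = refl
  lastOf-split (a ∷ A) refl = lastOf-++ a A

  len-split : ∀ {x} (s : APath M x) xs {w ys} → verts s ≡ xs ++ w ∷ ys →
    len s ≡ length xs + length ys
  len-split s xs {w} {ys} eq = suc-injective (begin
    suc (len s)                 ≡⟨ cong length eq ⟩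
    length (xs ++ w ∷ ys)       ≡⟨ length-++ xs ⟩
    length xs + suc (length ys) ≡⟨ +-suc (length xs) (length ys) ⟩
    suc (length xs + length ys) ∎)
    where open ≡-Reasoning

  position-≤-len : ∀ {x} (s : APath M x) xs {w ys} → verts s ≡ xs ++ w ∷ ys → length xs ≤ len s
  position-≤-len s xs {ys = ys} eq =
    subst (length xs ≤_) (sym (len-split s xs eq)) (m≤m+n (length xs) (length ys))

  end-∈⇒meets : ∀ {x S} (s : APath M x) → x ∈ S → Any (_∈ S) (verts s)
  end-∈⇒meets {S = S} s x∈S = Any.map (λ x≡z → subst (_∈ S) x≡z x∈S)
    (subst (_∈ verts s) (ends s) (lastOf-∈ (start s) (rest s)))

  lastOf-suffix : ∀ {v u} (p : APath M v) A {D} → verts p ≡ A ++ u ∷ D → lastOf M u D ≡ v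
  lastOf-suffix p A eq = trans (sym (lastOf-split A eq)) (ends p)

  graft : ∀ {x y} (s : APath M x) pre {w post} → verts s ≡ pre ++ w ∷ post →
    ∀ ys → AltWalk (alternate (length pre) 0ℙ) (w ∷ ys) → Unique (w ∷ ys) →
    Disjoint pre (w ∷ ys) → lastOf M w ys ≡ y → Σ[ q ∈ APath M y ] len q ≡ length pre + length ys
  graft s [] eq ys walk uniq _ end =
    record { start = _ ; rest = ys
           ; unmatched = subst (Unmatched M) (∷-injectiveˡ eq) (unmatched s)
           ; alt = AltWalk⇒Alternating _ walk ; simple = uniq ; ends = end } , refl
  graft s (z ∷ pre) {w} {post} eq ys walk uniq disjoint end =
    record { start = z ; rest = pre ++ w ∷ ys
           ; unmatched = subst (Unmatched M) (∷-injectiveˡ eq) (unmatched s)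
           ; alt = AltWalk⇒Alternating _ (AltWalk-++⁺ (z ∷ pre) s-init walk)
           ; simple = Unique.++⁺ (Unique-++⁻ˡ (z ∷ pre) (subst Unique eq (simple s))) uniq disjoint
           ; ends = trans (lastOf-++ z pre) end } ,
    trans (length-++ pre) (+-suc (length pre) (length ys))
    where
    s-init : AltWalk 0ℙ ((z ∷ pre) ∷ʳ w)
    s-init = AltWalk-++⁻ˡ ((z ∷ pre) ∷ʳ w) (subst (AltWalk 0ℙ)
               (trans eq (sym (++-assoc (z ∷ pre) (w ∷ []) post))) (APath-AltWalk s))

  prefix-path : ∀ {v u} (p : APath M v) A {D} → verts p ≡ A ++ u ∷ D →
    Σ[ q ∈ APath M u ] len q ≡ length A
  prefix-path p A eq
    with q , |q| ← graft p A eq [] tt ([] ∷ []) (λ { (u∈A , here refl) →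
                     Unique-++-∷⇒∉ A (subst Unique eq (simple p)) u∈A }) refl
    = q , trans |q| (+-identityʳ (length A))

  -- a is the position on s, and b the position on p, of the first vertex of s on p[u to v].
  data Rerouted {v} (p : APath M v) (u : V) (i ℓ : ℕ) : Set where
    rejoins : ∀ {a b} → a ≤ ℓ → i ≤ b → parity a ≡ parity b →
              (p′ : APath M v) → len p′ + b ≡ a + len p → Rerouted p u i ℓ
    returns : ∀ {a b} → a ≤ ℓ → b ≤ len p → parity a ≢ parity b →
              (q : APath M u) → len q + i ≡ a + b → Rerouted p u i ℓ

  module FirstMeeting {v u x w} (p : APath M v) (A B C : List V) (p≡ : verts p ≡ A ++ B ++ w ∷ C)
                      (to-u : lastOf M w (reverse B) ≡ u) (s : APath M x) (pre post : List V)
                      (s≡ : verts s ≡ pre ++ w ∷ post) (pre∉ : All (_∉ B ++ w ∷ C) pre) where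

    a i b : ℕ
    a = length pre
    i = length A
    b = length (A ++ B)

    b≡i+|B| : b ≡ i + length B
    b≡i+|B| = length-++ A

    p≡′ : verts p ≡ (A ++ B) ++ w ∷ C
    p≡′ = trans p≡ (sym (++-assoc A B (w ∷ C)))

    avoids : ∀ {ys} → (∀ {z} → z ∈ ys → z ∈ B ++ w ∷ C) → Disjoint pre ys
    avoids sub (z∈pre , z∈ys) = All.lookup pre∉ z∈pre (sub z∈ys)

    segment-unique : Unique (B ++ w ∷ C)
    segment-unique = Unique-++⁻ʳ A (subst Unique p≡ (simple p))

    shortcut-to-v : parity a ≡ parity b → Σ[ p′ ∈ APath M v ] len p′ ≡ a + length C
    shortcut-to-v same =
      graft s pre s≡ C walk (Unique-++⁻ʳ B segment-unique) (avoids (∈-++⁺ʳ B))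
        (lastOf-suffix p (A ++ B) p≡′)
      where
      kind : alternate b 0ℙ ≡ alternate a 0ℙ
      kind = trans (alternate-0ℙ b) (trans (sym same) (sym (alternate-0ℙ a)))
      walk : AltWalk (alternate a 0ℙ) (w ∷ C)
      walk = subst (λ κ → AltWalk κ (w ∷ C)) kind
               (AltWalk-++⁻ʳ (A ++ B) (subst (AltWalk 0ℙ) p≡′ (APath-AltWalk p)))

    shortcut-to-u : parity a ≢ parity b → Σ[ q ∈ APath M u ] len q ≡ a + length (reverse B)
    shortcut-to-u differ = graft s pre s≡ (reverse B) walk unique (avoids back⊆segment) to-u
      where
      open ≡-Reasoning
      kind : alternate (length (B ∷ʳ w)) (alternate i 0ℙ) ≡ alternate a 0ℙ
      kind = begin
        alternate (length (B ∷ʳ w)) (alternate i 0ℙ)  ≡⟨ alternate-+ i _ 0ℙ ⟨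
        alternate (i + length (B ∷ʳ w)) 0ℙ            ≡⟨ alternate-0ℙ (i + length (B ∷ʳ w)) ⟩
        parity (i + length (B ∷ʳ w))                  ≡⟨ cong (λ k → parity (i + k)) |B∷ʳw| ⟩
        parity (i + suc (length B))                   ≡⟨ cong parity (+-suc i (length B)) ⟩
        parity (suc (i + length B))                   ≡⟨ cong (parity ∘ suc) b≡i+|B| ⟨
        parity (suc b)                                ≡⟨ parity-suc b ⟩
        parity b ⁻¹                                   ≡⟨ ≢⇒≡⁻¹ differ ⟨
        parity a                                      ≡⟨ alternate-0ℙ a ⟨
        alternate a 0ℙ                                ∎
        where |B∷ʳw| = trans (length-++ B) (+-comm (length B) 1)
      B∷ʳw++C : B ++ w ∷ C ≡ (B ∷ʳ w) ++ C
      B∷ʳw++C = sym (++-assoc B (w ∷ []) C)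
      walk : AltWalk (alternate a 0ℙ) (w ∷ reverse B)
      walk = subst₂ AltWalk kind (reverse-++ B (w ∷ []))
               (AltWalk-reverse (B ∷ʳ w) (AltWalk-++⁻ˡ (B ∷ʳ w)
                 (subst (AltWalk (alternate i 0ℙ)) B∷ʳw++C
                   (AltWalk-++⁻ʳ A (subst (AltWalk 0ℙ) p≡ (APath-AltWalk p))))))
      unique : Unique (w ∷ reverse B)
      unique = subst Unique (reverse-++ B (w ∷ []))
                 (Unique-reverse (B ∷ʳ w)
                   (Unique-++⁻ˡ (B ∷ʳ w) (subst Unique B∷ʳw++C segment-unique)))
      back⊆segment : ∀ {z} → z ∈ w ∷ reverse B → z ∈ B ++ w ∷ C
      back⊆segment (here refl) = ∈-++⁺ʳ B (here refl)
      back⊆segment (there z∈)  = ∈-++⁺ˡ (Anyₚ.reverse⁻ {xs = B} z∈)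

    rerouted : Rerouted p u i (len s)
    rerouted with parity a ℙ.≟ parity b
    ... | yes same with p′ , |p′| ← shortcut-to-v same =
      rejoins (position-≤-len s pre s≡) (subst (i ≤_) (sym b≡i+|B|) (m≤m+n i (length B)))
        same p′ (begin
        len p′ + b          ≡⟨ cong (_+ b) |p′| ⟩
        a + length C + b    ≡⟨ +-assoc a (length C) b ⟩
        a + (length C + b)  ≡⟨ cong (a +_) (+-comm (length C) b) ⟩
        a + (b + length C)  ≡⟨ cong (a +_) (len-split p (A ++ B) p≡′) ⟨
        a + len p           ∎)
      where open ≡-Reasoning
    ... | no differ with q , |q| ← shortcut-to-u differ =
      returns (position-≤-len s pre s≡) (position-≤-len p (A ++ B) p≡′) differ q (begin
        len q + i                   ≡⟨ cong (_+ i) |q| ⟩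
        a + length (reverse B) + i  ≡⟨ cong (λ k → a + k + i) (length-reverse B) ⟩
        a + length B + i            ≡⟨ +-assoc a (length B) i ⟩
        a + (length B + i)          ≡⟨ cong (a +_) (+-comm (length B) i) ⟩
        a + (i + length B)          ≡⟨ cong (a +_) b≡i+|B| ⟨
        a + b                       ∎)
      where open ≡-Reasoning

  reroute : ∀ {v u x} (p : APath M v) A D → verts p ≡ A ++ u ∷ D →
    (s : APath M x) → x ∈ u ∷ D → Rerouted p u (length A) (len s)
  reroute {u = u} {x} p A D p≡ s x∈
    with pre , w , post , s≡ , pre∉ , w∈ ←
           split-at-first (_∈? u ∷ D) (verts s) (end-∈⇒meets s x∈)
    with B , C , u∷D≡ ← ∈-∃++ w∈
    = FirstMeeting.rerouted p A B C (trans p≡ (cong (A ++_) u∷D≡)) (to-u B u∷D≡) s pre post s≡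
        (subst (λ S → All (_∉ S) pre) u∷D≡ pre∉)
    where
    to-u : ∀ B {C} → u ∷ D ≡ B ++ w ∷ C → lastOf M w (reverse B) ≡ u
    to-u []      eq = sym (∷-injectiveˡ eq)
    to-u (b ∷ B) eq = trans (lastOf-reverse w b B) (sym (∷-injectiveˡ eq))

  ShortestOfItsParity : ∀ {v} → APath M v → Set
  ShortestOfItsParity {v} p =
    ∀ (p′ : APath M v) → parity (len p′) ≡ parity (len p) → len p ≤ len p′

  level-≤ : ∀ {Par u l} → IsLevel M Par u l → (q : APath M u) → Par (len q) → l ≤∞ fin (len q)
  level-≤ {l = fin _} (_ , minimal) = minimal
  level-≤ {l = ∞}     none          = none

  byParity-IsLevel : ∀ {u ev od} → IsEvenLevel M u ev → IsOddLevel M u od →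
    ∀ π → IsLevel M (HasParity π) u (byParity π ev od)
  byParity-IsLevel even _   0ℙ = even
  byParity-IsLevel _    odd 1ℙ = odd

  levelPath-byParity : ∀ {v ev od} (p : APath M v) → IsEvenLevelPath M p ev ⊎ IsOddLevelPath M p od →
    byParity (parity (len p)) ev od ≡ fin (len p)
  levelPath-byParity p (inj₁ (even , ≡ev)) =
    trans (cong (λ π → byParity π _ _) (HasParity⇒parity (len p) even)) (sym ≡ev)
  levelPath-byParity p (inj₂ (odd , ≡od)) =
    trans (cong (λ π → byParity π _ _) (HasParity⇒parity (len p) odd)) (sym ≡od)

  levelPath-shortest : ∀ {v ev od} → IsEvenLevel M v ev → IsOddLevel M v od →
    (p : APath M v) → IsEvenLevelPath M p ev ⊎ IsOddLevelPath M p od → ShortestOfItsParity p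
  levelPath-shortest {v} ev-v od-v p level-path p′ same =
    proj₂ p-level p′ (parity⇒HasParity (len p′) same)
    where
    p-level : IsLevel M (HasParity (parity (len p))) v (fin (len p))
    p-level = subst (IsLevel M _ v) (levelPath-byParity p level-path)
                (byParity-IsLevel ev-v od-v (parity (len p)))

  levelPath-tenacity : ∀ {v ev od} (p : APath M v) → IsEvenLevelPath M p ev ⊎ IsOddLevelPath M p od →
    ev +∞ od ≡ fin (len p) +∞ byParity (parity (len p) ⁻¹) ev od
  levelPath-tenacity {ev = ev} {od} p level-path =
    trans (sym (byParity-+∞ (parity (len p)) ev od))
      (cong (_+∞ byParity (parity (len p) ⁻¹) ev od) (levelPath-byParity p level-path))

  module OnShortestPath {v u} (p : APath M v) (shortest : ShortestOfItsParity p)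
                        (A D : List V) (p≡ : verts p ≡ A ++ u ∷ D) where

    i L : ℕ
    i = length A
    L = len p

    level-≤-position : ∀ {lq} → IsLevel M (HasParity (parity i)) u lq → lq ≤∞ fin i
    level-≤-position lq-level with q , |q| ← prefix-path p A p≡
      = subst (λ k → _ ≤∞ fin k) |q|
          (level-≤ lq-level q (parity⇒HasParity (len q) (cong parity |q|)))

    end-∈-suffix : v ∈ u ∷ D
    end-∈-suffix = subst (_∈ u ∷ D) (lastOf-suffix p A p≡) (lastOf-∈ u D)

    detour : ∀ {x lo} → IsLevel M (HasParity (parity i ⁻¹)) u lo →
      (s : APath M x) → x ∈ u ∷ D →
      i ≤ len s ⊎ Σ[ m ∈ ℕ ] lo ≡ fin m × m + i ≤ len s + L
    detour lo-level s x∈ with reroute p A D p≡ s x∈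
    ... | rejoins {a} {b} a≤ℓ i≤b same p′ eq = inj₁ (≤-trans i≤b (≤-trans b≤a a≤ℓ))
      where
      open ≤-Reasoning
      b≤a : b ≤ a
      b≤a = +-cancelˡ-≤ L b a (begin
        L + b       ≤⟨ +-monoˡ-≤ b (shortest p′ (parity-cancel (len p′) b a L eq same)) ⟩
        len p′ + b  ≡⟨ eq ⟩
        a + L       ≡⟨ +-comm a L ⟩
        L + a       ∎)
    ... | returns {a} {b} a≤ℓ b≤L differ q eq
      with m , refl , m≤|q| ← ≤∞-fin (level-≤ lo-level q
                                 (parity⇒HasParity (len q) (parity-opposite (len q) i a b eq differ)))
      = inj₂ (m , refl , ≤-trans (+-monoˡ-≤ i m≤|q|)
                             (subst (_≤ len s + L) (sym eq) (+-mono-≤ a≤ℓ b≤L)))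

    shorter-path-violates-bound : ∀ {L′ lo} →
      IsLevel M (HasParity (parity L ⁻¹)) v L′ → IsLevel M (HasParity (parity i ⁻¹)) u lo →
      (q : APath M u) → len q < i → ¬ ((fin L +∞ L′) ≤∞ (fin (len q) +∞ lo))
    shorter-path-violates-bound L′-level lo-level q k<i bound with detour lo-level q (here refl)
    ... | inj₁ i≤k = <⇒≱ k<i i≤k
    ... | inj₂ (m , refl , m+i≤k+L)
      with l′ , refl , L+l′≤k+m ← +∞-≤∞-fin L bound
      with (r , refl , _) , _ ← L′-level
      with detour lo-level r end-∈-suffix
    ... | inj₁ i≤l′ = <-irrefl refl (begin-strict
        i + i + m      ≤⟨ +-monoˡ-≤ m (+-monoˡ-≤ i i≤l′) ⟩
        l′ + i + m     ≡⟨ +-assoc l′ i m ⟩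
        l′ + (i + m)   ≡⟨ cong (l′ +_) (+-comm i m) ⟩
        l′ + (m + i)   ≤⟨ +-monoʳ-≤ l′ m+i≤k+L ⟩
        l′ + (k + L)   ≡⟨ rearrange l′ k L ⟩
        k + (L + l′)   ≤⟨ +-monoʳ-≤ k L+l′≤k+m ⟩
        k + (k + m)    ≡⟨ +-assoc k k m ⟨
        k + k + m      <⟨ +-monoˡ-< m (+-mono-< k<i k<i) ⟩
        i + i + m      ∎)
      where
      open ≤-Reasoning
      k = len q
      rearrange : ∀ l k L → l + (k + L) ≡ k + (L + l)
      rearrange = solve-∀
    ... | inj₂ (_ , refl , m+i≤l′+L) = <-irrefl refl (begin-strict
        m + i          ≤⟨ m+i≤l′+L ⟩
        len r + L      ≡⟨ +-comm (len r) L ⟩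
        L + len r      ≤⟨ L+l′≤k+m ⟩
        len q + m      <⟨ +-monoˡ-< m k<i ⟩
        i + m          ≡⟨ +-comm i m ⟩
        m + i          ∎)
      where open ≤-Reasoning

    level-at-position : ∀ {L′ lq lo} →
      IsLevel M (HasParity (parity L ⁻¹)) v L′ →
      IsLevel M (HasParity (parity i)) u lq → IsLevel M (HasParity (parity i ⁻¹)) u lo →
      (fin L +∞ L′) ≤∞ (lq +∞ lo) → lq ≡ fin i
    level-at-position {lq = ∞}     _ lq-level _ _ = ⊥-elim (level-≤-position lq-level)
    level-at-position {lq = fin _} L′-level lq-level@((q , refl , _) , _) lo-level bound
      with m≤n⇒m<n∨m≡n (level-≤-position lq-level)
    ... | inj₁ k<i = ⊥-elim (shorter-path-violates-bound L′-level lo-level q k<i bound)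
    ... | inj₂ k≡i = cong fin k≡i

    position-is-minlevel : ∀ {L′ lo} →
      IsLevel M (HasParity (parity L ⁻¹)) v L′ → IsLevel M (HasParity (parity i ⁻¹)) u lo →
      (fin L +∞ L′) <∞ (fin i +∞ lo) → fin i ≡ min∞ (fin i) lo
    position-is-minlevel {lo = ∞}     _ _ _ = refl
    position-is-minlevel {lo = fin m} L′-level lo-level strict with i ≤? m
    ... | yes i≤m = cong fin (sym (m≤n⇒m⊓n≡m i≤m))
    ... | no i≰m
      with l′ , refl , L+l′<i+m ← +∞-<∞-fin L strict
      with (r , refl , _) , _ ← L′-level
      with detour lo-level r end-∈-suffix
    ... | inj₁ i≤l′ = ⊥-elim (<-irrefl refl (begin-strict
        i + m          <⟨ +-monoʳ-< i (≰⇒> i≰m) ⟩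
        i + i          ≤⟨ +-mono-≤ (position-≤-len p A p≡) i≤l′ ⟩
        L + len r      <⟨ L+l′<i+m ⟩
        i + m          ∎))
      where open ≤-Reasoning
    ... | inj₂ (_ , refl , m+i≤l′+L) = ⊥-elim (<-irrefl refl (begin-strict
        m + i          ≤⟨ m+i≤l′+L ⟩
        len r + L      ≡⟨ +-comm (len r) L ⟩
        L + len r      <⟨ L+l′<i+m ⟩
        i + m          ≡⟨ +-comm i m ⟩
        m + i          ∎))
      where open ≤-Reasoning

    bfs-honest : ∀ {L′ ev od} → IsLevel M (HasParity (parity L ⁻¹)) v L′ →
      IsEvenLevel M u ev → IsOddLevel M u od → (fin L +∞ L′) ≤∞ (ev +∞ od) →
      BFSHonest i ev od × ((fin L +∞ L′) <∞ (ev +∞ od) → fin i ≡ min∞ ev od)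
    bfs-honest {L′} {ev} {od} L′-level ev-u od-u bound = byParity-BFSHonest i ev od lq≡i , minimal
      where
      κ : Parity
      κ = parity i
      lq lo : ℕ∞
      lq = byParity κ ev od
      lo = byParity (κ ⁻¹) ev od
      tenacity-u : ev +∞ od ≡ lq +∞ lo
      tenacity-u = sym (byParity-+∞ κ ev od)
      lq-level : IsLevel M (HasParity κ) u lq
      lq-level = byParity-IsLevel ev-u od-u κ
      lo-level : IsLevel M (HasParity (κ ⁻¹)) u lo
      lo-level = byParity-IsLevel ev-u od-u (κ ⁻¹)
      lq≡i : lq ≡ fin i
      lq≡i = level-at-position L′-level lq-level lo-level (subst ((fin L +∞ L′) ≤∞_) tenacity-u bound)
      minimal : (fin L +∞ L′) <∞ (ev +∞ od) → fin i ≡ min∞ ev od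
      minimal strict = begin
        fin i           ≡⟨ position-is-minlevel L′-level lo-level
                             (subst ((fin L +∞ L′) <∞_) (trans tenacity-u (cong (_+∞ lo) lq≡i)) strict) ⟩
        min∞ (fin i) lo ≡⟨ cong (λ l → min∞ l lo) lq≡i ⟨
        min∞ lq lo      ≡⟨ byParity-min∞ κ ev od ⟩
        min∞ ev od      ∎
        where open ≡-Reasoning

theorem5p2 : ∀ {n} (G : Graph n) (M : Matching G) (v u : Fin n)
    (evv odv evu odu : ℕ∞) →
    IsEvenLevel M v evv → IsOddLevel M v odv →
    IsEvenLevel M u evu → IsOddLevel M u odu →
    (p : APath M v) → (IsEvenLevelPath M p evv ⊎ IsOddLevelPath M p odv) →
    (i : Fin (length (verts p))) → lookup (verts p) i ≡ u →
    (evv +∞ odv) ≤∞ (evu +∞ odu) →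
    BFSHonest (toℕ i) evu odu
    × ((evv +∞ odv) <∞ (evu +∞ odu) → fin (toℕ i) ≡ min∞ evu odu)
theorem5p2 G M v _ evv odv evu odu ev-v od-v ev-u od-u p level-path i refl bound
  with A , D , p≡ , |A|≡i ← lookup-split (verts p) i
  rewrite sym |A|≡i | levelPath-tenacity M p level-path
  = OnShortestPath.bfs-honest M p (levelPath-shortest M ev-v od-v p level-path) A D p≡
      (byParity-IsLevel M ev-v od-v (parity (len p) ⁻¹)) ev-u od-u bound
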